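{- Let $D=(V,A)$ be a strongly connected finite simple digraph, let $e=(u,v)$ be a strong bridge of $D$, and let $(V_{source},V_{sink})$ be a partition of $V$ such that $e$ is the unique arc directed from $V_{source}$ to $V_{sink}$ (so $u\in V_{source}$, $v\in V_{sink}$). Let $S$ be a mutual-visibility set of $D$ with $S\cap V_{source}\neq\emptyset$ and $S\cap V_{sink}\neq\emptyset$. Then: (1) if $u\in S$, then $S\cap V_{source}=\{u\}$; (2) if $v\in S$, then $S\cap V_{sink}=\{v\}$.
   Context: A digraph $D=(V,A)$ has a finite vertex set and arcs that are ordered pairs of distinct vertices, with no parallel arcs. A strong bridge is an arc whose removal increases the number of strongly connected components. A shortest directed $x,y$-path is a directed path (distinct vertices) from $x$ to $y$ of minimum length; its internal vertices are those other than its endpoints. A set $S\subseteq V$ is a mutual-visibility set of $D$ if for all distinct $x,y\in S$ there exist a shortest directed $x,y$-path $P$ and a shortest directed $y,x$-path $Q$ such that $(S\cap V(P))\cup(S\cap V(Q))=\{x,y\}$. -}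

module Defs where

open import Data.Nat using (ℕ; zero; suc; _≤_; _<_; _<ᵇ_)
open import Data.Bool using (Bool; true; false; T; _∧_; _∨_; not)
open import Data.Fin using (Fin; toℕ; _≟_)
open import Data.List using (List; []; _∷_; filterᵇ; length; allFin)
open import Data.Bool.ListAction using (any; all)
open import Data.List.Relation.Unary.Unique.Propositional using (Unique)
open import Data.Product using (Σ; _×_; _,_)
open import Relation.Binary.PropositionalEquality using (_≡_)
open import Relation.Nullary using (¬_)
open import Relation.Nullary.Decidable using (⌊_⌋)

-- A finite simple digraph on vertex set Fin n: adjacency matrix with no loops.
-- (A relation has no parallel arcs by construction.)
record Digraph (n : ℕ) : Set where
  field
    adj      : Fin n → Fin n → Bool
    loopless : ∀ x → adj x x ≡ false
open Digraph public

Arc : {n : ℕ} → Digraph n → Fin n → Fin n → Set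
Arc D x y = T (adj D x y)

data Walk {n : ℕ} (D : Digraph n) : Fin n → Fin n → Set where
  []  : ∀ {x} → Walk D x x
  _∷_ : ∀ {x y z} → Arc D x y → Walk D y z → Walk D x z

vertices : ∀ {n} {D : Digraph n} {x y} → Walk D x y → List (Fin n)
vertices {x = x} []      = x ∷ []
vertices {x = x} (_ ∷ w) = x ∷ vertices w

len : ∀ {n} {D : Digraph n} {x y} → Walk D x y → ℕ
len []      = zero
len (_ ∷ w) = suc (len w)

Path : ∀ {n} → Digraph n → Fin n → Fin n → Set
Path D x y = Σ (Walk D x y) (λ w → Unique (vertices w))

pathLen : ∀ {n} {D : Digraph n} {x y} → Path D x y → ℕ
pathLen (w , _) = len w

pathVertices : ∀ {n} {D : Digraph n} {x y} → Path D x y → List (Fin n)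
pathVertices (w , _) = vertices w

ShortestPath : ∀ {n} → Digraph n → Fin n → Fin n → Set
ShortestPath D x y = Σ (Path D x y) (λ P → ∀ (Q : Path D x y) → pathLen P ≤ pathLen Q)

StronglyConnected : ∀ {n} → Digraph n → Set
StronglyConnected D = ∀ x y → Path D x y

removeArc : ∀ {n} → Digraph n → Fin n → Fin n → Digraph n
removeArc D u v = record
  { adj = λ x y → adj D x y ∧ not (⌊ x ≟ u ⌋ ∧ ⌊ y ≟ v ⌋)
  ; loopless = λ x → lem x }
  where
  open import Data.Bool.Properties using ()
  open import Relation.Binary.PropositionalEquality using (cong)
  lem : ∀ x → adj D x x ∧ not (⌊ x ≟ u ⌋ ∧ ⌊ x ≟ v ⌋) ≡ false
  lem x = cong (λ b → b ∧ not (⌊ x ≟ u ⌋ ∧ ⌊ x ≟ v ⌋)) (loopless D x)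

reachB : ∀ {n} → Digraph n → ℕ → Fin n → Fin n → Bool
reachB D zero    x y = ⌊ x ≟ y ⌋
reachB {n} D (suc k) x y = reachB D k x y ∨ any (λ z → reachB D k x z ∧ adj D z y) (allFin n)

sameSCC : ∀ {n} → Digraph n → Fin n → Fin n → Bool
sameSCC {n} D x y = reachB D n x y ∧ reachB D n y x

-- number of strongly connected components = number of vertices that are
-- the least (w.r.t. the order of Fin n) vertex of their component
numSCC : ∀ {n} → Digraph n → ℕ
numSCC {n} D = length (filterᵇ (λ x → all (λ y → not ((toℕ y <ᵇ toℕ x) ∧ sameSCC D x y)) (allFin n)) (allFin n))

StrongBridge : ∀ {n} → Digraph n → Fin n → Fin n → Set
StrongBridge D u v = Arc D u v × numSCC D < numSCC (removeArc D u v)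

{-# OPTIONS --safe #-}
-- Every walk from Vsource to Vsink must use the arc (u,v), so u and v lie on
-- every such walk, in particular on every shortest path from a vertex of S on
-- one side to a vertex of S on the other. Mutual visibility forbids a third
-- vertex of S on that path, so u (resp. v) can only be the path's endpoint on
-- its own side.
module Submission where

open import Defs
open import Data.Nat using (ℕ)
open import Data.Fin using (Fin)
open import Data.Fin.Subset using (Subset; _∈_; _∉_)
open import Data.Product using (_×_; Σ-syntax; proj₁; proj₂; _,_)
open import Data.Sum using (_⊎_; inj₁; inj₂)
open import Data.Empty using (⊥-elim)
open import Data.List.Membership.Propositional using () renaming (_∈_ to _∈ₗ_)
open import Data.List.Relation.Unary.Any using (here; there)
open import Relation.Binary.PropositionalEquality using (_≡_; _≢_; refl; sym)
open import Function.Bundles using (_⇔_; mk⇔; Equivalence)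

MutualVisibility : ∀ {n} → Digraph n → Subset n → Set
MutualVisibility D S = ∀ x y → x ∈ S → y ∈ S → x ≢ y →
  Σ[ P ∈ ShortestPath D x y ] Σ[ Q ∈ ShortestPath D y x ]
    (∀ z → ((z ∈ S × z ∈ₗ pathVertices (proj₁ P)) ⊎ (z ∈ S × z ∈ₗ pathVertices (proj₁ Q)))
           ⇔ (z ≡ x ⊎ z ≡ y))

Unavoidable : ∀ {n} → Digraph n → Fin n → Fin n → Fin n → Set
Unavoidable D w x y = ∀ (p : Walk D x y) → w ∈ₗ vertices p

module _ {n} {D : Digraph n} where

  start∈vertices : ∀ {x y} (p : Walk D x y) → x ∈ₗ vertices p
  start∈vertices []      = here refl
  start∈vertices (_ ∷ _) = here refl

  visible-unavoidable⇒endpoint : ∀ {S x y w} → MutualVisibility D S →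
    x ∈ S → y ∈ S → x ≢ y → w ∈ S → Unavoidable D w x y → w ≡ x ⊎ w ≡ y
  visible-unavoidable⇒endpoint vis x∈S y∈S x≢y w∈S w-on =
    let (((p , _) , _) , _ , P-sees-only-ends) = vis _ _ x∈S y∈S x≢y
    in Equivalence.to (P-sees-only-ends _) (inj₁ (w∈S , w-on p))

module Cut {n} (D : Digraph n) (u v : Fin n) (Vsource Vsink : Subset n)
  (cover : ∀ x → x ∈ Vsource ⊎ x ∈ Vsink)
  (disjoint : ∀ x → x ∈ Vsource → x ∉ Vsink)
  (uniqueCrossing : ∀ x y → Arc D x y → x ∈ Vsource → y ∈ Vsink → (x ≡ u × y ≡ v))
  where

  source≢sink : ∀ {x y} → x ∈ Vsource → y ∈ Vsink → x ≢ y
  source≢sink {x} x∈src y∈snk refl = disjoint x x∈src y∈snk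

  crossing-visits-bridge : ∀ {x y} (p : Walk D x y) → x ∈ Vsource → y ∈ Vsink →
    u ∈ₗ vertices p × v ∈ₗ vertices p
  crossing-visits-bridge {x} [] x∈src x∈snk = ⊥-elim (disjoint x x∈src x∈snk)
  crossing-visits-bridge {x} (_∷_ {y = m} a p) x∈src y∈snk with cover m
  ... | inj₁ m∈src = let (u∈p , v∈p) = crossing-visits-bridge p m∈src y∈snk
                     in there u∈p , there v∈p
  ... | inj₂ m∈snk with uniqueCrossing x m a x∈src m∈snk
  ...   | refl , refl = here refl , there (start∈vertices p)

  bridgeTail-unavoidable : ∀ {x y} → x ∈ Vsource → y ∈ Vsink → Unavoidable D u x y
  bridgeTail-unavoidable x∈src y∈snk p = proj₁ (crossing-visits-bridge p x∈src y∈snk)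

  bridgeHead-unavoidable : ∀ {x y} → x ∈ Vsource → y ∈ Vsink → Unavoidable D v x y
  bridgeHead-unavoidable x∈src y∈snk p = proj₂ (crossing-visits-bridge p x∈src y∈snk)

mainTheorem5 : ∀ {n : ℕ} (D : Digraph n) (u v : Fin n) (Vsource Vsink S : Subset n)
    → StronglyConnected D
    → StrongBridge D u v
    → (∀ x → x ∈ Vsource ⊎ x ∈ Vsink)
    → (∀ x → x ∈ Vsource → x ∉ Vsink)
    → u ∈ Vsource → v ∈ Vsink
    → (∀ x y → Arc D x y → x ∈ Vsource → y ∈ Vsink → (x ≡ u × y ≡ v))
    → (∀ x y → x ∈ S → y ∈ S → x ≢ y →
         Σ[ P ∈ ShortestPath D x y ] Σ[ Q ∈ ShortestPath D y x ]
           (∀ z → ((z ∈ S × z ∈ₗ pathVertices (proj₁ P)) ⊎ (z ∈ S × z ∈ₗ pathVertices (proj₁ Q)))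
                  ⇔ (z ≡ x ⊎ z ≡ y)))
    → Σ[ s ∈ Fin n ] (s ∈ S × s ∈ Vsource)
    → Σ[ t ∈ Fin n ] (t ∈ S × t ∈ Vsink)
    → ((u ∈ S → ∀ z → (z ∈ S × z ∈ Vsource) ⇔ z ≡ u)
       × (v ∈ S → ∀ z → (z ∈ S × z ∈ Vsink) ⇔ z ≡ v))
mainTheorem5 D u v Vsource Vsink S _ _ cover disjoint u∈src v∈snk uniqueCrossing vis
             (s , s∈S , s∈src) (t , t∈S , t∈snk) =
    (λ u∈S z → mk⇔ (only-u u∈S) λ { refl → u∈S , u∈src })
  , (λ v∈S z → mk⇔ (only-v v∈S) λ { refl → v∈S , v∈snk })
  where
  open Cut D u v Vsource Vsink cover disjoint uniqueCrossing

  only-u : u ∈ S → ∀ {z} → z ∈ S × z ∈ Vsource → z ≡ u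
  only-u u∈S (z∈S , z∈src)
    with visible-unavoidable⇒endpoint vis z∈S t∈S (source≢sink z∈src t∈snk) u∈S
           (bridgeTail-unavoidable z∈src t∈snk)
  ... | inj₁ u≡z = sym u≡z
  ... | inj₂ u≡t = ⊥-elim (source≢sink u∈src t∈snk u≡t)

  only-v : v ∈ S → ∀ {z} → z ∈ S × z ∈ Vsink → z ≡ v
  only-v v∈S (z∈S , z∈snk)
    with visible-unavoidable⇒endpoint vis s∈S z∈S (source≢sink s∈src z∈snk) v∈S
           (bridgeHead-unavoidable s∈src z∈snk)
  ... | inj₁ v≡s = ⊥-elim (source≢sink s∈src v∈snk (sym v≡s))
  ... | inj₂ v≡z = sym v≡z
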